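{- For all integers $n\ge2$, the numbers $a_n=\sum_{k=1}^{n}(-1)^{k-1}(k-1)!\,c(n,k)$ satisfy $$a_n=\sum_{k=1}^{n-1}\binom{n-2}{k-1}\bigl((k-1)!-a_k\bigr)a_{n-k}.$$
   Context: $c(n,k)$ denotes the (unsigned) Stirling number of the first kind: the number of permutations of $\{1,\dots,n\}$ with exactly $k$ cycles. -}

module Defs where

open import Data.Nat using (ℕ; zero; suc; _+_; _*_; _∸_; _!)
open import Data.Nat.Combinatorics using (_C_)
open import Data.Integer using (ℤ; +_; -_) renaming (_+_ to _+ℤ_; _*_ to _*ℤ_)

stirling1 : ℕ → ℕ → ℕ
stirling1 zero    zero    = 1
stirling1 zero    (suc k) = 0
stirling1 (suc n) zero    = 0
stirling1 (suc n) (suc k) = n * stirling1 n (suc k) + stirling1 n k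

sumFrom1 : ℕ → (ℕ → ℤ) → ℤ
sumFrom1 zero    f = + 0
sumFrom1 (suc n) f = sumFrom1 n f +ℤ f (suc n)

sign : ℕ → ℤ
sign zero          = + 1
sign (suc zero)    = - (+ 1)
sign (suc (suc m)) = sign m

a : ℕ → ℤ
a n = sumFrom1 n (λ k → sign (k ∸ 1) *ℤ + ((k ∸ 1) ! * stirling1 n k))

{-# OPTIONS --safe #-}
-- Work with exponential generating functions.  With L = −log(1 − x), the k-th
-- column of c has EGF L^k/k!, so the EGF of (a_n) is A = ∑ (−1)^{k−1} L^k/k,
-- i.e. A = log(1 + L).  Rather than taking logarithms, multiply by 1 − x:
-- (1 − x) A′ = ∑ (−L)^k, and the geometric series telescopes against 1 + L,
-- giving A′ (1 + L) = 1/(1 − x).  As L′ = 1/(1 − x) and (1/(1 − x))′ = 1/(1 − x)²,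
-- differentiating yields A″ (1 + L) = (1/(1 − x) − A′) A′ (1 + L); cancelling
-- 1 + L leaves A″ = (1/(1 − x) − A′) A′, whose coefficients are the recurrence.
module Submission where

open import Defs
open import Data.Nat using (ℕ; zero; suc; _≤_; _<_; _∸_; _!; z≤n; s≤s)
import Data.Nat as ℕ
import Data.Nat.Properties as ℕₚ
open import Data.Nat.Combinatorics using (_C_; nCn≡1; nCk+nC[k+1]≡[n+1]C[k+1])
open import Data.Nat.Combinatorics.Specification using (k>n⇒nCk≡0)
open import Data.Integer using (ℤ; +_; _+_; _*_; _-_; -_)
open import Data.Integer.Properties
  using ( +-comm; +-assoc; +-identityˡ; +-identityʳ; +-inverseʳ; +-minus-telescope
        ; +-commutativeSemigroup; *-zeroˡ; *-zeroʳ; *-assoc; *-distribˡ-+; neg-distrib-+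
        ; pos-+; pos-*; suc-*; -1*i≡-i; i-j≡0⇒i≡j)
open import Algebra.Properties.CommutativeSemigroup +-commutativeSemigroup
  using (interchange; x∙yz≈y∙xz)
open import Data.Integer.Tactic.RingSolver using (solve-∀)
open import Data.Sum using (inj₁; inj₂)
open import Relation.Binary.PropositionalEquality

i+j-j≡i : ∀ i j → i + j - j ≡ i
i+j-j≡i = solve-∀

∑≤ : ℕ → (ℕ → ℤ) → ℤ
∑≤ zero    f = f 0
∑≤ (suc n) f = ∑≤ n f + f (suc n)

infix 5 ∑≤
syntax ∑≤ n (λ j → e) = ∑[ j ≤ n ] e

∑-cong≤ : ∀ n {f g : ℕ → ℤ} → (∀ j → j ≤ n → f j ≡ g j) → ∑≤ n f ≡ ∑≤ n g
∑-cong≤ zero    f≡g = f≡g 0 z≤n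
∑-cong≤ (suc n) f≡g =
  cong₂ _+_ (∑-cong≤ n (λ j j≤n → f≡g j (ℕₚ.m≤n⇒m≤1+n j≤n))) (f≡g (suc n) ℕₚ.≤-refl)

∑-cong : ∀ n {f g : ℕ → ℤ} → f ≗ g → ∑≤ n f ≡ ∑≤ n g
∑-cong n f≗g = ∑-cong≤ n (λ j _ → f≗g j)

∑-zero : ∀ n → ∑[ j ≤ n ] + 0 ≡ + 0
∑-zero zero    = refl
∑-zero (suc n) = cong (_+ + 0) (∑-zero n)

∑-distrib-+ : ∀ n (f g : ℕ → ℤ) → ∑[ j ≤ n ] (f j + g j) ≡ ∑≤ n f + ∑≤ n g
∑-distrib-+ zero    f g = refl
∑-distrib-+ (suc n) f g =
  trans (cong (_+ (f (suc n) + g (suc n))) (∑-distrib-+ n f g))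
        (interchange (∑≤ n f) (∑≤ n g) (f (suc n)) (g (suc n)))

∑-distribˡ-* : ∀ n c (f : ℕ → ℤ) → ∑[ j ≤ n ] (c * f j) ≡ c * ∑≤ n f
∑-distribˡ-* zero    c f = refl
∑-distribˡ-* (suc n) c f =
  trans (cong (_+ c * f (suc n)) (∑-distribˡ-* n c f))
        (sym (*-distribˡ-+ c (∑≤ n f) (f (suc n))))

∑-neg : ∀ n (f : ℕ → ℤ) → ∑[ j ≤ n ] (- f j) ≡ - ∑≤ n f
∑-neg zero    f = refl
∑-neg (suc n) f =
  trans (cong (_+ - f (suc n)) (∑-neg n f)) (sym (neg-distrib-+ (∑≤ n f) (f (suc n))))

∑-unfoldˡ : ∀ n (f : ℕ → ℤ) → ∑≤ (suc n) f ≡ f 0 + (∑[ j ≤ n ] f (suc j))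
∑-unfoldˡ zero    f = refl
∑-unfoldˡ (suc n) f =
  trans (cong (_+ f (suc (suc n))) (∑-unfoldˡ n f))
        (+-assoc (f 0) (∑[ j ≤ n ] f (suc j)) (f (suc (suc n))))

∑-extend : ∀ {n} K {f : ℕ → ℤ} → n ≤ K → (∀ k → n < k → f k ≡ + 0) → ∑≤ n f ≡ ∑≤ K f
∑-extend zero    z≤n    _       = refl
∑-extend {n} (suc K) {f} n≤1+K f≡0 with ℕₚ.m≤n⇒m<n∨m≡n n≤1+K
... | inj₁ (s≤s n≤K) = begin
  ∑≤ n f              ≡⟨ ∑-extend K n≤K f≡0 ⟩
  ∑≤ K f              ≡⟨ +-identityʳ _ ⟨
  ∑≤ K f + + 0        ≡⟨ cong (_+_ (∑≤ K f)) (f≡0 (suc K) (s≤s n≤K)) ⟨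
  ∑≤ (suc K) f        ∎
  where open ≡-Reasoning
... | inj₂ refl = refl

sumFrom1-suc : ∀ n (f : ℕ → ℤ) → sumFrom1 (suc n) f ≡ ∑[ j ≤ n ] f (suc j)
sumFrom1-suc zero    f = +-identityˡ (f 1)
sumFrom1-suc (suc n) f = cong (_+ f (suc (suc n))) (sumFrom1-suc n f)

-- An exponential generating function ∑ fₙ xⁿ/n! is represented by (fₙ): the
-- product is then the binomial convolution and the derivative the shift.
Series : Set
Series = ℕ → ℤ

infixl 6 _⊕_ _⊖_
infixl 7 _⋆_ _·_

D : Series → Series
D f n = f (suc n)

_⋆_ : Series → Series → Series
(f ⋆ g) n = ∑[ j ≤ n ] (+ (n C j) * f j * g (n ∸ j))

_⊕_ : Series → Series → Series
(f ⊕ g) n = f n + g n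

_⊖_ : Series → Series → Series
(f ⊖ g) n = f n - g n

_·_ : ℤ → Series → Series
(c · f) n = c * f n

𝟘 : Series
𝟘 _ = + 0

𝟙 : Series
𝟙 zero    = + 1
𝟙 (suc _) = + 0

⋆-cong≤ : ∀ n {f f′ g g′ : Series} →
  (∀ j → j ≤ n → f j ≡ f′ j) → (∀ j → j ≤ n → g j ≡ g′ j) → (f ⋆ g) n ≡ (f′ ⋆ g′) n
⋆-cong≤ n f≡f′ g≡g′ = ∑-cong≤ n λ j j≤n →
  cong₂ (λ x y → + (n C j) * x * y) (f≡f′ j j≤n) (g≡g′ (n ∸ j) (ℕₚ.m∸n≤m n j))

⋆-congˡ : ∀ f {g g′ : Series} → g ≗ g′ → f ⋆ g ≗ f ⋆ g′
⋆-congˡ f g≗g′ n = ⋆-cong≤ n {f = f} {f′ = f} (λ _ _ → refl) (λ j _ → g≗g′ j)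

⋆-congʳ : ∀ {f f′ : Series} g → f ≗ f′ → f ⋆ g ≗ f′ ⋆ g
⋆-congʳ g f≗f′ n = ⋆-cong≤ n {g = g} {g′ = g} (λ j _ → f≗f′ j) (λ _ _ → refl)

⋆-zeroʳ : ∀ f → f ⋆ 𝟘 ≗ 𝟘
⋆-zeroʳ f n = trans (∑-cong n λ j → *-zeroʳ (+ (n C j) * f j)) (∑-zero n)

⋆-distribˡ-⊕ : ∀ h f g → h ⋆ (f ⊕ g) ≗ h ⋆ f ⊕ h ⋆ g
⋆-distribˡ-⊕ h f g n =
  trans (∑-cong n λ j → expand (+ (n C j)) (h j) (f (n ∸ j)) (g (n ∸ j))) (∑-distrib-+ n _ _)
  where
  expand : ∀ c x y z → c * x * (y + z) ≡ c * x * y + c * x * z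
  expand = solve-∀

⋆-distribʳ-⊕ : ∀ h f g → (f ⊕ g) ⋆ h ≗ f ⋆ h ⊕ g ⋆ h
⋆-distribʳ-⊕ h f g n =
  trans (∑-cong n λ j → expand (+ (n C j)) (f j) (g j) (h (n ∸ j))) (∑-distrib-+ n _ _)
  where
  expand : ∀ c x y z → c * (x + y) * z ≡ c * x * z + c * y * z
  expand = solve-∀

⋆-distribʳ-⊖ : ∀ h f g → (f ⊖ g) ⋆ h ≗ f ⋆ h ⊖ g ⋆ h
⋆-distribʳ-⊖ h f g n =
  trans (∑-cong n λ j → expand (+ (n C j)) (f j) (g j) (h (n ∸ j)))
        (trans (∑-distrib-+ n _ _) (cong (_+_ ((f ⋆ h) n)) (∑-neg n _)))
  where
  expand : ∀ c x y z → c * (x - y) * z ≡ c * x * z + - (c * y * z)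
  expand = solve-∀

⋆-scalarˡ : ∀ c f g → (c · f) ⋆ g ≗ c · (f ⋆ g)
⋆-scalarˡ c f g n =
  trans (∑-cong n λ j → pull (+ (n C j)) c (f j) (g (n ∸ j))) (∑-distribˡ-* n c _)
  where
  pull : ∀ b c x y → b * (c * x) * y ≡ c * (b * x * y)
  pull = solve-∀

⋆-scalarʳ : ∀ c f g → f ⋆ (c · g) ≗ c · (f ⋆ g)
⋆-scalarʳ c f g n =
  trans (∑-cong n λ j → pull (+ (n C j)) c (f j) (g (n ∸ j))) (∑-distribˡ-* n c _)
  where
  pull : ∀ b c x y → b * x * (c * y) ≡ c * (b * x * y)
  pull = solve-∀

⋆-distribˡ-∑ : ∀ h K (F : ℕ → Series) →
  h ⋆ (λ n → ∑[ k ≤ K ] F k n) ≗ λ n → ∑[ k ≤ K ] (h ⋆ F k) n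
⋆-distribˡ-∑ h zero    F n = refl
⋆-distribˡ-∑ h (suc K) F n =
  trans (⋆-distribˡ-⊕ h (λ m → ∑[ k ≤ K ] F k m) (F (suc K)) n)
        (cong (_+ (h ⋆ F (suc K)) n) (⋆-distribˡ-∑ h K F n))

D-⋆ : ∀ f g → D (f ⋆ g) ≗ D f ⋆ g ⊕ f ⋆ D g
D-⋆ f g n = begin
    (f ⋆ g) (suc n)
  ≡⟨ ∑-unfoldˡ n _ ⟩
    f₀ + (∑[ j ≤ n ] (+ (suc n C suc j) * f (suc j) * g (n ∸ j)))
  ≡⟨ cong (_+_ f₀) (∑-cong n pascal) ⟩
    f₀ + (∑[ j ≤ n ] (+ (n C j) * f (suc j) * g (n ∸ j)
                      + + (n C suc j) * f (suc j) * g (n ∸ j)))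
  ≡⟨ cong (_+_ f₀) (∑-distrib-+ n _ _) ⟩
    f₀ + ((D f ⋆ g) n + rest)
  ≡⟨ x∙yz≈y∙xz f₀ ((D f ⋆ g) n) rest ⟩
    (D f ⋆ g) n + (f₀ + rest)
  ≡⟨ cong (_+_ ((D f ⋆ g) n)) (sym (∑-unfoldˡ n _)) ⟩
    (D f ⋆ g) n + (∑[ j ≤ suc n ] (+ (n C j) * f j * g (suc n ∸ j)))
  ≡⟨ cong (_+_ ((D f ⋆ g) n)) (sym (∑-extend (suc n) (ℕₚ.n≤1+n n) beyond-n)) ⟩
    (D f ⋆ g) n + (∑[ j ≤ n ] (+ (n C j) * f j * g (suc n ∸ j)))
  ≡⟨ cong (_+_ ((D f ⋆ g) n)) (∑-cong≤ n λ j j≤n →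
       cong (λ i → + (n C j) * f j * g i) (ℕₚ.+-∸-assoc 1 j≤n)) ⟩
    (D f ⋆ g) n + (f ⋆ D g) n
  ∎
  where
  open ≡-Reasoning
  f₀ : ℤ
  f₀ = + 1 * f 0 * g (suc n)
  rest : ℤ
  rest = ∑[ j ≤ n ] (+ (n C suc j) * f (suc j) * g (n ∸ j))
  pascal : ∀ j → + (suc n C suc j) * f (suc j) * g (n ∸ j)
               ≡ + (n C j) * f (suc j) * g (n ∸ j) + + (n C suc j) * f (suc j) * g (n ∸ j)
  pascal j = begin
    + (suc n C suc j) * f (suc j) * g (n ∸ j)
      ≡⟨ cong (λ c → + c * f (suc j) * g (n ∸ j)) (sym (nCk+nC[k+1]≡[n+1]C[k+1] n j)) ⟩
    + (n C j ℕ.+ n C suc j) * f (suc j) * g (n ∸ j)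
      ≡⟨ cong (λ c → c * f (suc j) * g (n ∸ j)) (pos-+ (n C j) (n C suc j)) ⟩
    (+ (n C j) + + (n C suc j)) * f (suc j) * g (n ∸ j)
      ≡⟨ expand (+ (n C j)) (+ (n C suc j)) (f (suc j)) (g (n ∸ j)) ⟩
    + (n C j) * f (suc j) * g (n ∸ j) + + (n C suc j) * f (suc j) * g (n ∸ j) ∎
    where
    expand : ∀ b c x y → (b + c) * x * y ≡ b * x * y + c * x * y
    expand = solve-∀
  beyond-n : ∀ k → n < k → + (n C k) * f k * g (suc n ∸ k) ≡ + 0
  beyond-n k n<k rewrite k>n⇒nCk≡0 n<k = refl

-- A series is determined by its constant term and its derivative, so the ring
-- laws below follow by induction on the index from the Leibniz rule.
⋆-comm : ∀ f g → f ⋆ g ≗ g ⋆ f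
⋆-comm f g zero    = swap (f 0) (g 0)
  where
  swap : ∀ x y → + 1 * x * y ≡ + 1 * y * x
  swap = solve-∀
⋆-comm f g (suc n) = begin
  (f ⋆ g) (suc n)           ≡⟨ D-⋆ f g n ⟩
  (D f ⋆ g) n + (f ⋆ D g) n ≡⟨ cong₂ _+_ (⋆-comm (D f) g n) (⋆-comm f (D g) n) ⟩
  (g ⋆ D f) n + (D g ⋆ f) n ≡⟨ +-comm ((g ⋆ D f) n) ((D g ⋆ f) n) ⟩
  (D g ⋆ f) n + (g ⋆ D f) n ≡⟨ D-⋆ g f n ⟨
  (g ⋆ f) (suc n)           ∎
  where open ≡-Reasoning

⋆-assoc : ∀ f g h → (f ⋆ g) ⋆ h ≗ f ⋆ (g ⋆ h)
⋆-assoc f g h zero    = reassoc (f 0) (g 0) (h 0)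
  where
  reassoc : ∀ x y z → + 1 * (+ 1 * x * y) * z ≡ + 1 * x * (+ 1 * y * z)
  reassoc = solve-∀
⋆-assoc f g h (suc n) = begin
    ((f ⋆ g) ⋆ h) (suc n)
  ≡⟨ D-⋆ (f ⋆ g) h n ⟩
    (D (f ⋆ g) ⋆ h) n + ((f ⋆ g) ⋆ D h) n
  ≡⟨ cong (_+ ((f ⋆ g) ⋆ D h) n)
          (trans (⋆-congʳ h (D-⋆ f g) n) (⋆-distribʳ-⊕ h (D f ⋆ g) (f ⋆ D g) n)) ⟩
    ((D f ⋆ g) ⋆ h) n + ((f ⋆ D g) ⋆ h) n + ((f ⋆ g) ⋆ D h) n
  ≡⟨ cong₂ _+_ (cong₂ _+_ (⋆-assoc (D f) g h n) (⋆-assoc f (D g) h n))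
               (⋆-assoc f g (D h) n) ⟩
    (D f ⋆ (g ⋆ h)) n + (f ⋆ (D g ⋆ h)) n + (f ⋆ (g ⋆ D h)) n
  ≡⟨ +-assoc ((D f ⋆ (g ⋆ h)) n) ((f ⋆ (D g ⋆ h)) n) ((f ⋆ (g ⋆ D h)) n) ⟩
    (D f ⋆ (g ⋆ h)) n + ((f ⋆ (D g ⋆ h)) n + (f ⋆ (g ⋆ D h)) n)
  ≡⟨ cong (_+_ ((D f ⋆ (g ⋆ h)) n))
          (trans (⋆-congˡ f (D-⋆ g h) n) (⋆-distribˡ-⊕ f (D g ⋆ h) (g ⋆ D h) n)) ⟨
    (D f ⋆ (g ⋆ h)) n + (f ⋆ D (g ⋆ h)) n
  ≡⟨ D-⋆ f (g ⋆ h) n ⟨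
    (f ⋆ (g ⋆ h)) (suc n)
  ∎
  where open ≡-Reasoning

⋆-identityʳ : ∀ f → f ⋆ 𝟙 ≗ f
⋆-identityʳ f zero    = unit (f 0)
  where
  unit : ∀ x → + 1 * x * + 1 ≡ x
  unit = solve-∀
⋆-identityʳ f (suc n) = begin
  (f ⋆ 𝟙) (suc n)           ≡⟨ D-⋆ f 𝟙 n ⟩
  (D f ⋆ 𝟙) n + (f ⋆ 𝟘) n   ≡⟨ cong₂ _+_ (⋆-identityʳ (D f) n) (⋆-zeroʳ f n) ⟩
  f (suc n) + + 0           ≡⟨ +-identityʳ (f (suc n)) ⟩
  f (suc n)                 ∎
  where open ≡-Reasoning

⋆-identityˡ : ∀ f → 𝟙 ⋆ f ≗ f
⋆-identityˡ f n = trans (⋆-comm 𝟙 f n) (⋆-identityʳ f n)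

-- The top term of (z ⋆ w)(n) is z n · w 0, so z vanishes by strong induction.
⋆-zero-divisorʳ : ∀ w z → w 0 ≡ + 1 → z ⋆ w ≗ 𝟘 → z ≗ 𝟘
⋆-zero-divisorʳ w z w₀≡1 z⋆w≗0 n = upTo n n ℕₚ.≤-refl
  where
  open ≡-Reasoning
  top : ∀ n → + (n C n) * z n * w (n ∸ n) ≡ z n
  top n rewrite nCn≡1 n | ℕₚ.n∸n≡0 n | w₀≡1 = unit (z n)
    where
    unit : ∀ x → + 1 * x * + 1 ≡ x
    unit = solve-∀
  upTo : ∀ n j → j ≤ n → z j ≡ + 0
  upTo zero    zero    z≤n = trans (sym (top 0)) (z⋆w≗0 0)
  upTo (suc n) j j≤1+n with ℕₚ.m≤n⇒m<n∨m≡n j≤1+n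
  ... | inj₁ (s≤s j≤n) = upTo n j j≤n
  ... | inj₂ refl      = begin
    z (suc n)                                  ≡⟨ top (suc n) ⟨
    + (suc n C suc n) * z (suc n) * w (n ∸ n)  ≡⟨ +-identityˡ _ ⟨
    + 0 + + (suc n C suc n) * z (suc n) * w (n ∸ n)
      ≡⟨ cong (_+ + (suc n C suc n) * z (suc n) * w (n ∸ n)) lower ⟨
    (z ⋆ w) (suc n)                            ≡⟨ z⋆w≗0 (suc n) ⟩
    + 0                                        ∎
    where
    annihilate : ∀ c y → c * + 0 * y ≡ + 0
    annihilate = solve-∀
    lower : ∑[ i ≤ n ] (+ (suc n C i) * z i * w (suc n ∸ i)) ≡ + 0
    lower = trans (∑-cong≤ n λ i i≤n →
                    trans (cong (λ x → + (suc n C i) * x * w (suc n ∸ i)) (upTo n i i≤n))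
                          (annihilate (+ (suc n C i)) (w (suc n ∸ i))))
                  (∑-zero n)

⋆-cancelʳ : ∀ w f g → w 0 ≡ + 1 → f ⋆ w ≗ g ⋆ w → f ≗ g
⋆-cancelʳ w f g w₀≡1 f⋆w≗g⋆w n =
  i-j≡0⇒i≡j (f n) (g n) (⋆-zero-divisorʳ w (f ⊖ g) w₀≡1 [f⊖g]⋆w≗0 n)
  where
  [f⊖g]⋆w≗0 : (f ⊖ g) ⋆ w ≗ 𝟘
  [f⊖g]⋆w≗0 m = trans (⋆-distribʳ-⊖ w f g m)
                 (trans (cong (_- (g ⋆ w) m) (f⋆w≗g⋆w m)) (+-inverseʳ ((g ⋆ w) m)))

⋆-cancelˡ : ∀ w f g → w 0 ≡ + 1 → w ⋆ f ≗ w ⋆ g → f ≗ g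
⋆-cancelˡ w f g w₀≡1 w⋆f≗w⋆g =
  ⋆-cancelʳ w f g w₀≡1 λ n → trans (⋆-comm f w n) (trans (w⋆f≗w⋆g n) (⋆-comm w g n))

1-x : Series
1-x zero          = + 1
1-x (suc zero)    = - + 1
1-x (suc (suc _)) = + 0

1/[1-x] : Series
1/[1-x] n = + (n !)

D-1-x-⋆ : ∀ h n → (D 1-x ⋆ h) n ≡ - h n
D-1-x-⋆ h n = begin
  (D 1-x ⋆ h) n        ≡⟨ ⋆-congʳ h D-1-x n ⟩
  (- + 1 · 𝟙 ⋆ h) n    ≡⟨ ⋆-scalarˡ (- + 1) 𝟙 h n ⟩
  - + 1 * (𝟙 ⋆ h) n    ≡⟨ cong (- + 1 *_) (⋆-identityˡ h n) ⟩
  - + 1 * h n          ≡⟨ -1*i≡-i (h n) ⟩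
  - h n                ∎
  where
  open ≡-Reasoning
  D-1-x : D 1-x ≗ - + 1 · 𝟙
  D-1-x zero    = refl
  D-1-x (suc _) = refl

1-x-⋆-suc : ∀ h m → (1-x ⋆ h) (suc m) ≡ h (suc m) - + suc m * h m
1-x-⋆-suc h zero    = twoTerms (h 0) (h 1)
  where
  twoTerms : ∀ x y → + 1 * + 1 * y + + 1 * - + 1 * x ≡ y - + 1 * x
  twoTerms = solve-∀
1-x-⋆-suc h (suc m) = begin
  (1-x ⋆ h) (suc (suc m))
    ≡⟨ D-⋆ 1-x h (suc m) ⟩
  (D 1-x ⋆ h) (suc m) + (1-x ⋆ D h) (suc m)
    ≡⟨ cong₂ _+_ (D-1-x-⋆ h (suc m)) (1-x-⋆-suc (D h) m) ⟩
  - h (suc m) + (h (suc (suc m)) - + suc m * h (suc m))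
    ≡⟨ collect (h (suc m)) (h (suc (suc m))) (+ suc m) ⟩
  h (suc (suc m)) - + suc (suc m) * h (suc m)
    ∎
  where
  open ≡-Reasoning
  collect : ∀ x y c → - x + (y - c * x) ≡ y - (+ 1 + c) * x
  collect = solve-∀

1-x-⋆-recurrence : ∀ h g →
  h 0 ≡ g 0 → (∀ m → h (suc m) ≡ g (suc m) + + suc m * h m) → 1-x ⋆ h ≗ g
1-x-⋆-recurrence h g h₀≡g₀ step zero    = trans (unit (h 0)) h₀≡g₀
  where
  unit : ∀ x → + 1 * + 1 * x ≡ x
  unit = solve-∀
1-x-⋆-recurrence h g h₀≡g₀ step (suc m) = begin
  (1-x ⋆ h) (suc m)                                  ≡⟨ 1-x-⋆-suc h m ⟩
  h (suc m) - + suc m * h m                          ≡⟨ cong (_- + suc m * h m) (step m) ⟩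
  g (suc m) + + suc m * h m - + suc m * h m          ≡⟨ i+j-j≡i (g (suc m)) (+ suc m * h m) ⟩
  g (suc m)                                          ∎
  where open ≡-Reasoning

1-x-⋆-1/[1-x] : 1-x ⋆ 1/[1-x] ≗ 𝟙
1-x-⋆-1/[1-x] = 1-x-⋆-recurrence 1/[1-x] 𝟙 refl λ m →
  trans (pos-* (suc m) (m !)) (sym (+-identityˡ (+ suc m * + (m !))))

1-x-⋆-D-1/[1-x] : 1-x ⋆ D 1/[1-x] ≗ 1/[1-x]
1-x-⋆-D-1/[1-x] = 1-x-⋆-recurrence (D 1/[1-x]) 1/[1-x] refl λ m →
  trans (pos-+ (suc m !) (suc m ℕ.* suc m !)) (cong (_+_ (+ (suc m !))) (pos-* (suc m) (suc m !)))

D-1/[1-x] : D 1/[1-x] ≗ 1/[1-x] ⋆ 1/[1-x]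
D-1/[1-x] = ⋆-cancelˡ 1-x (D 1/[1-x]) (1/[1-x] ⋆ 1/[1-x]) refl λ n → begin
  (1-x ⋆ D 1/[1-x]) n             ≡⟨ 1-x-⋆-D-1/[1-x] n ⟩
  1/[1-x] n                       ≡⟨ ⋆-identityˡ 1/[1-x] n ⟨
  (𝟙 ⋆ 1/[1-x]) n                 ≡⟨ ⋆-congʳ 1/[1-x] 1-x-⋆-1/[1-x] n ⟨
  (1-x ⋆ 1/[1-x] ⋆ 1/[1-x]) n     ≡⟨ ⋆-assoc 1-x 1/[1-x] 1/[1-x] n ⟩
  (1-x ⋆ (1/[1-x] ⋆ 1/[1-x])) n   ∎
  where open ≡-Reasoning

-- stirling k is the EGF L^k/k! of L = −log(1 − x).
stirling : ℕ → Series
stirling k n = + stirling1 n k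

L : Series
L = stirling 1

1+L : Series
1+L = 𝟙 ⊕ L

stirling-vanish : ∀ {n k} → n < k → stirling1 n k ≡ 0
stirling-vanish {zero}  {suc k} _         = refl
stirling-vanish {suc n} {suc k} (s≤s n<k)
  rewrite stirling-vanish (ℕₚ.m<n⇒m<1+n n<k) | stirling-vanish n<k | ℕₚ.*-zeroʳ n = refl

stirling-0 : stirling 0 ≗ 𝟙
stirling-0 zero    = refl
stirling-0 (suc n) = refl

1-x-⋆-D-stirling : ∀ k → 1-x ⋆ D (stirling (suc k)) ≗ stirling k
1-x-⋆-D-stirling k = 1-x-⋆-recurrence (D (stirling (suc k))) (stirling k) refl λ m →
  trans (pos-+ (suc m ℕ.* stirling1 (suc m) (suc k)) (stirling1 (suc m) k))
        (trans (+-comm (+ (suc m ℕ.* stirling1 (suc m) (suc k))) (+ stirling1 (suc m) k))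
               (cong (_+_ (+ stirling1 (suc m) k)) (pos-* (suc m) (stirling1 (suc m) (suc k)))))

D-L : D L ≗ 1/[1-x]
D-L = ⋆-cancelˡ 1-x (D L) 1/[1-x] refl λ n →
  trans (1-x-⋆-D-stirling 0 n) (trans (stirling-0 n) (sym (1-x-⋆-1/[1-x] n)))

1-x-⋆-⋆-D-L : ∀ f → 1-x ⋆ (f ⋆ D L) ≗ f
1-x-⋆-⋆-D-L f n = begin
  (1-x ⋆ (f ⋆ D L)) n       ≡⟨ ⋆-assoc 1-x f (D L) n ⟨
  (1-x ⋆ f ⋆ D L) n         ≡⟨ ⋆-congʳ (D L) (⋆-comm 1-x f) n ⟩
  (f ⋆ 1-x ⋆ D L) n         ≡⟨ ⋆-assoc f 1-x (D L) n ⟩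
  (f ⋆ (1-x ⋆ D L)) n       ≡⟨ ⋆-congˡ f 1-x-⋆-D-L n ⟩
  (f ⋆ 𝟙) n                 ≡⟨ ⋆-identityʳ f n ⟩
  f n                       ∎
  where
  open ≡-Reasoning
  1-x-⋆-D-L : 1-x ⋆ D L ≗ 𝟙
  1-x-⋆-D-L m = trans (1-x-⋆-D-stirling 0 m) (stirling-0 m)

stirling-⋆-L : ∀ k → stirling k ⋆ L ≗ + suc k · stirling (suc k)
1-x-⋆-D-stirling-⋆-L : ∀ k → 1-x ⋆ (D (stirling k) ⋆ L) ≗ + k · stirling k

stirling-⋆-L k zero    = trans (*-zeroʳ (+ 1 * + stirling1 0 k)) (sym (*-zeroʳ (+ suc k)))
stirling-⋆-L k (suc n) =
  ⋆-cancelˡ 1-x (D (stirling k ⋆ L)) (D (+ suc k · stirling (suc k))) refl derivatives n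
  where
  open ≡-Reasoning
  derivatives : 1-x ⋆ D (stirling k ⋆ L) ≗ 1-x ⋆ D (+ suc k · stirling (suc k))
  derivatives m = begin
    (1-x ⋆ D (stirling k ⋆ L)) m
      ≡⟨ ⋆-congˡ 1-x (D-⋆ (stirling k) L) m ⟩
    (1-x ⋆ (D (stirling k) ⋆ L ⊕ stirling k ⋆ D L)) m
      ≡⟨ ⋆-distribˡ-⊕ 1-x (D (stirling k) ⋆ L) (stirling k ⋆ D L) m ⟩
    (1-x ⋆ (D (stirling k) ⋆ L)) m + (1-x ⋆ (stirling k ⋆ D L)) m
      ≡⟨ cong₂ _+_ (1-x-⋆-D-stirling-⋆-L k m) (1-x-⋆-⋆-D-L (stirling k) m) ⟩
    + k * stirling k m + stirling k m
      ≡⟨ +-comm (+ k * stirling k m) (stirling k m) ⟩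
    stirling k m + + k * stirling k m
      ≡⟨ suc-* (+ k) (stirling k m) ⟨
    + suc k * stirling k m
      ≡⟨ cong (_*_ (+ suc k)) (1-x-⋆-D-stirling k m) ⟨
    + suc k * (1-x ⋆ D (stirling (suc k))) m
      ≡⟨ ⋆-scalarʳ (+ suc k) 1-x (D (stirling (suc k))) m ⟨
    (1-x ⋆ D (+ suc k · stirling (suc k))) m ∎

1-x-⋆-D-stirling-⋆-L zero    n = begin
  (1-x ⋆ (𝟘 ⋆ L)) n      ≡⟨ ⋆-congˡ 1-x 𝟘⋆L≗𝟘 n ⟩
  (1-x ⋆ 𝟘) n            ≡⟨ ⋆-zeroʳ 1-x n ⟩
  + 0                    ≡⟨ *-zeroˡ (stirling 0 n) ⟨
  + 0 * stirling 0 n     ∎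
  where
  open ≡-Reasoning
  𝟘⋆L≗𝟘 : 𝟘 ⋆ L ≗ 𝟘
  𝟘⋆L≗𝟘 m = trans (⋆-comm 𝟘 L m) (⋆-zeroʳ L m)
1-x-⋆-D-stirling-⋆-L (suc k) n = begin
  (1-x ⋆ (D (stirling (suc k)) ⋆ L)) n   ≡⟨ ⋆-assoc 1-x (D (stirling (suc k))) L n ⟨
  (1-x ⋆ D (stirling (suc k)) ⋆ L) n     ≡⟨ ⋆-congʳ L (1-x-⋆-D-stirling k) n ⟩
  (stirling k ⋆ L) n                     ≡⟨ stirling-⋆-L k n ⟩
  + suc k * stirling (suc k) n           ∎
  where open ≡-Reasoning

sign-suc : ∀ k → sign (suc k) ≡ - sign k
sign-suc zero          = refl
sign-suc (suc zero)    = refl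
sign-suc (suc (suc k)) = sign-suc k

signedFactorial : ℕ → ℤ
signedFactorial k = sign k * + (k !)

signedFactorial-suc : ∀ k → signedFactorial (suc k) ≡ - (signedFactorial k * + suc k)
signedFactorial-suc k = begin
  sign (suc k) * + (suc k !)        ≡⟨ cong₂ _*_ (sign-suc k) (pos-* (suc k) (k !)) ⟩
  - sign k * (+ suc k * + (k !))    ≡⟨ rearrange (sign k) (+ suc k) (+ (k !)) ⟩
  - (sign k * + (k !) * + suc k)    ∎
  where
  open ≡-Reasoning
  rearrange : ∀ s c f → - s * (c * f) ≡ - (s * f * c)
  rearrange = solve-∀

[-L]^_ : ℕ → Series
[-L]^ k = signedFactorial k · stirling k

[-L]^-vanish : ∀ {n k} → n < k → ([-L]^ k) n ≡ + 0
[-L]^-vanish {k = k} n<k rewrite stirling-vanish n<k = *-zeroʳ (signedFactorial k)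

[-L]^-⋆-1+L : ∀ k → [-L]^ k ⋆ 1+L ≗ [-L]^ k ⊖ [-L]^ suc k
[-L]^-⋆-1+L k n = begin
  ([-L]^ k ⋆ 1+L) n
    ≡⟨ ⋆-scalarˡ (signedFactorial k) (stirling k) 1+L n ⟩
  signedFactorial k * (stirling k ⋆ (𝟙 ⊕ L)) n
    ≡⟨ cong (_*_ (signedFactorial k)) (⋆-distribˡ-⊕ (stirling k) 𝟙 L n) ⟩
  signedFactorial k * ((stirling k ⋆ 𝟙) n + (stirling k ⋆ L) n)
    ≡⟨ cong (_*_ (signedFactorial k)) (cong₂ _+_ (⋆-identityʳ (stirling k) n)
                                                  (stirling-⋆-L k n)) ⟩
  signedFactorial k * (stirling k n + + suc k * stirling (suc k) n)
    ≡⟨ expand (signedFactorial k) (+ suc k) (stirling k n) (stirling (suc k) n) ⟩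
  signedFactorial k * stirling k n - - (signedFactorial k * + suc k) * stirling (suc k) n
    ≡⟨ cong (λ c → signedFactorial k * stirling k n - c * stirling (suc k) n)
            (signedFactorial-suc k) ⟨
  ([-L]^ k ⊖ [-L]^ suc k) n
    ∎
  where
  open ≡-Reasoning
  expand : ∀ s c x y → s * (x + c * y) ≡ s * x - - (s * c) * y
  expand = solve-∀

geometric : ℕ → Series
geometric K n = ∑[ k ≤ K ] ([-L]^ k) n

geometric-⋆-1+L : ∀ K → geometric K ⋆ 1+L ≗ 𝟙 ⊖ [-L]^ suc K
geometric-⋆-1+L zero    n = trans ([-L]^-⋆-1+L 0 n) (cong (_- ([-L]^ 1) n) [-L]^0≡𝟙)
  where
  unit : ∀ x → + 1 * x ≡ x
  unit = solve-∀
  [-L]^0≡𝟙 : ([-L]^ 0) n ≡ 𝟙 n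
  [-L]^0≡𝟙 = trans (unit (stirling 0 n)) (stirling-0 n)
geometric-⋆-1+L (suc K) n = begin
  (geometric (suc K) ⋆ 1+L) n
    ≡⟨ ⋆-distribʳ-⊕ 1+L (geometric K) ([-L]^ suc K) n ⟩
  (geometric K ⋆ 1+L) n + ([-L]^ suc K ⋆ 1+L) n
    ≡⟨ cong₂ _+_ (geometric-⋆-1+L K n) ([-L]^-⋆-1+L (suc K) n) ⟩
  (𝟙 n - ([-L]^ suc K) n) + (([-L]^ suc K) n - ([-L]^ suc (suc K)) n)
    ≡⟨ +-minus-telescope (𝟙 n) (([-L]^ suc K) n) (([-L]^ suc (suc K)) n) ⟩
  (𝟙 ⊖ [-L]^ suc (suc K)) n
    ∎
  where open ≡-Reasoning

D-a-expansion : ∀ {K j} → j ≤ K →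
  D a j ≡ ∑[ k ≤ K ] (signedFactorial k * stirling (suc k) (suc j))
D-a-expansion {K} {j} j≤K = begin
  a (suc j)                                                  ≡⟨ sumFrom1-suc j _ ⟩
  ∑[ k ≤ j ] (sign k * + (k ! ℕ.* stirling1 (suc j) (suc k))) ≡⟨ ∑-cong j factor ⟩
  ∑[ k ≤ j ] (signedFactorial k * stirling (suc k) (suc j))  ≡⟨ ∑-extend K j≤K beyond-j ⟩
  ∑[ k ≤ K ] (signedFactorial k * stirling (suc k) (suc j))  ∎
  where
  open ≡-Reasoning
  factor : ∀ k → sign k * + (k ! ℕ.* stirling1 (suc j) (suc k))
               ≡ signedFactorial k * stirling (suc k) (suc j)
  factor k = trans (cong (_*_ (sign k)) (pos-* (k !) (stirling1 (suc j) (suc k))))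
                   (sym (*-assoc (sign k) (+ (k !)) (stirling (suc k) (suc j))))
  beyond-j : ∀ k → j < k → signedFactorial k * stirling (suc k) (suc j) ≡ + 0
  beyond-j k j<k rewrite stirling-vanish (s≤s j<k) = *-zeroʳ (signedFactorial k)

1-x-⋆-D-a : ∀ {K j} → j ≤ K → (1-x ⋆ D a) j ≡ geometric K j
1-x-⋆-D-a {K} {j} j≤K = begin
  (1-x ⋆ D a) j
    ≡⟨ ⋆-cong≤ j {1-x} {1-x} (λ _ _ → refl) (λ i i≤j → D-a-expansion (ℕₚ.≤-trans i≤j j≤K)) ⟩
  (1-x ⋆ (λ i → ∑[ k ≤ K ] (signedFactorial k · D (stirling (suc k))) i)) j
    ≡⟨ ⋆-distribˡ-∑ 1-x K (λ k → signedFactorial k · D (stirling (suc k))) j ⟩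
  ∑[ k ≤ K ] (1-x ⋆ (signedFactorial k · D (stirling (suc k)))) j
    ≡⟨ ∑-cong K (λ k → trans (⋆-scalarʳ (signedFactorial k) 1-x (D (stirling (suc k))) j)
                             (cong (_*_ (signedFactorial k)) (1-x-⋆-D-stirling k j))) ⟩
  geometric K j
    ∎
  where open ≡-Reasoning

-- At index n only the coefficients of A′ up to n enter; there (1 − x) A′ agrees
-- with geometric n, whose error term (−L)^{n+1} has no coefficient below n + 1.
D-a-⋆-1+L : D a ⋆ 1+L ≗ 1/[1-x]
D-a-⋆-1+L = ⋆-cancelˡ 1-x (D a ⋆ 1+L) 1/[1-x] refl λ n → begin
  (1-x ⋆ (D a ⋆ 1+L)) n                        ≡⟨ ⋆-assoc 1-x (D a) 1+L n ⟨
  (1-x ⋆ D a ⋆ 1+L) n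
    ≡⟨ ⋆-cong≤ n {g = 1+L} {g′ = 1+L} (λ j → 1-x-⋆-D-a) (λ _ _ → refl) ⟩
  (geometric n ⋆ 1+L) n                        ≡⟨ geometric-⋆-1+L n n ⟩
  𝟙 n - ([-L]^ suc n) n                        ≡⟨ cong (λ x → 𝟙 n - x) ([-L]^-vanish (ℕₚ.n<1+n n)) ⟩
  𝟙 n - + 0                                    ≡⟨ +-identityʳ (𝟙 n) ⟩
  𝟙 n                                          ≡⟨ 1-x-⋆-1/[1-x] n ⟨
  (1-x ⋆ 1/[1-x]) n                            ∎
  where open ≡-Reasoning

D-1+L : D 1+L ≗ 1/[1-x]
D-1+L n = trans (+-identityˡ (L (suc n))) (D-L n)

D²a : D (D a) ≗ (1/[1-x] ⊖ D a) ⋆ D a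
D²a = ⋆-cancelʳ 1+L (D (D a)) ((1/[1-x] ⊖ D a) ⋆ D a) refl λ n → begin
  (D (D a) ⋆ 1+L) n                              ≡⟨ leibniz n ⟩
  (D a ⋆ 1+L) (suc n) - (D a ⋆ D 1+L) n
    ≡⟨ cong₂ _-_ (D-a-⋆-1+L (suc n)) (⋆-congˡ (D a) D-1+L n) ⟩
  1/[1-x] (suc n) - (D a ⋆ 1/[1-x]) n            ≡⟨ cong (_- (D a ⋆ 1/[1-x]) n) (D-1/[1-x] n) ⟩
  (1/[1-x] ⋆ 1/[1-x]) n - (D a ⋆ 1/[1-x]) n      ≡⟨ ⋆-distribʳ-⊖ 1/[1-x] 1/[1-x] (D a) n ⟨
  ((1/[1-x] ⊖ D a) ⋆ 1/[1-x]) n                  ≡⟨ ⋆-congˡ (1/[1-x] ⊖ D a) D-a-⋆-1+L n ⟨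
  ((1/[1-x] ⊖ D a) ⋆ (D a ⋆ 1+L)) n              ≡⟨ ⋆-assoc (1/[1-x] ⊖ D a) (D a) 1+L n ⟨
  ((1/[1-x] ⊖ D a) ⋆ D a ⋆ 1+L) n                ∎
  where
  open ≡-Reasoning
  leibniz : ∀ m → (D (D a) ⋆ 1+L) m ≡ (D a ⋆ 1+L) (suc m) - (D a ⋆ D 1+L) m
  leibniz m = sym (trans (cong (_- (D a ⋆ D 1+L) m) (D-⋆ (D a) 1+L m))
                         (i+j-j≡i ((D (D a) ⋆ 1+L) m) ((D a ⋆ D 1+L) m)))

mainTheorem11 : (n : ℕ) → 2 ≤ n →
    a n ≡ sumFrom1 (n ∸ 1) (λ k → (+ ((n ∸ 2) C (k ∸ 1)) * ((+ ((k ∸ 1) !)) - a k)) * a (n ∸ k))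
mainTheorem11 (suc (suc m)) (s≤s (s≤s _)) = begin
  a (suc (suc m))
    ≡⟨ D²a m ⟩
  ((1/[1-x] ⊖ D a) ⋆ D a) m
    ≡⟨ ∑-cong≤ m (λ j j≤m → cong (λ i → + (m C j) * (+ (j !) - a (suc j)) * a i)
                                 (ℕₚ.+-∸-assoc 1 j≤m)) ⟨
  ∑[ j ≤ m ] (+ (m C j) * (+ (j !) - a (suc j)) * a (suc m ∸ j))
    ≡⟨ sumFrom1-suc m _ ⟨
  sumFrom1 (suc m) (λ k → + (m C (k ∸ 1)) * (+ ((k ∸ 1) !) - a k) * a (suc (suc m) ∸ k))
    ∎
  where open ≡-Reasoning
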